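{- For every integer $k\ge 2$: (i) $rc^*(C_{2k}(\{1,k\})) = src^*(C_{2k}(\{1,k\})) = k$; (ii) $rc^*(C_{2k}(\{1,k+1\})) = src^*(C_{2k}(\{1,k+1\})) = k$.
   Context: For an integer $n\ge 2$ and $S\subseteq\{1,\dots,n-1\}$, the circulant digraph $C_n(S)$ has vertex set $\{v_0,\dots,v_{n-1}\}$ and arcs $v_iv_j$ whenever $j-i\equiv s \pmod n$ for some $s\in S$. For an arc-colouring of a strongly connected digraph $D$, a directed path is rainbow if no two of its arcs have the same colour. $rc^*(D)$ is the minimum number of colours in an arc-colouring such that for every ordered pair of distinct vertices $x,y$ there is a rainbow directed $xy$-path. $src^*(D)$ is the minimum number of colours in an arc-colouring such that for every ordered pair of distinct vertices $x,y$ there is a rainbow directed $xy$-path of length equal to the directed distance $d_D(x,y)$. -}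

module Defs where

open import Data.Nat using (ℕ; zero; suc; _+_; _*_; _≤_; _<_)
open import Data.Fin using (Fin; toℕ)
open import Data.List using (List; []; _∷_)
open import Data.List.Membership.Propositional using (_∈_)
open import Data.List.Relation.Unary.Unique.Propositional using (Unique)
open import Data.Product using (Σ; ∃; ∃-syntax; _×_)
open import Relation.Binary.PropositionalEquality using (_≡_; _≢_)
open import Relation.Nullary using (¬_)

Digraph : ℕ → Set₁
Digraph n = Fin n → Fin n → Set

-- Circulant digraph C_n(S): arc v_i v_j iff j - i ≡ s (mod n) for some s ∈ S,
-- i.e. i + s ≡ j + q * n for some q.
Circulant : (n : ℕ) → List ℕ → Digraph n
Circulant n S i j = ∃[ s ] (s ∈ S × ∃[ q ] (toℕ i + s ≡ toℕ j + q * n))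

module _ {n : ℕ} (D : Digraph n) where

  data Walk : Fin n → Fin n → Set where
    []  : ∀ {x} → Walk x x
    _∷_ : ∀ {x y z} → D x y → Walk y z → Walk x z

  vertices : ∀ {x y} → Walk x y → List (Fin n)
  vertices {x} []      = x ∷ []
  vertices {x} (_ ∷ w) = x ∷ vertices w

  len : ∀ {x y} → Walk x y → ℕ
  len []      = 0
  len (_ ∷ w) = suc (len w)

  IsPath : ∀ {x y} → Walk x y → Set
  IsPath w = Unique (vertices w)

  -- colours of the arcs of a walk under an arc-colouring
  -- (an arc-colouring with m colours is a map assigning to each arc v_i v_j
  -- a colour in Fin m; since arcs are ordered pairs it is given on pairs)
  colours : ∀ {m} → (Fin n → Fin n → Fin m) → ∀ {x y} → Walk x y → List (Fin m)
  colours c []            = []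
  colours c {x} (_∷_ {y = y} _ w) = c x y ∷ colours c w

  IsRainbow : ∀ {m} → (Fin n → Fin n → Fin m) → ∀ {x y} → Walk x y → Set
  IsRainbow c w = Unique (colours c w)

  RainbowConnecting : ∀ {m} → (Fin n → Fin n → Fin m) → Set
  RainbowConnecting c = ∀ x y → x ≢ y →
    Σ (Walk x y) λ p → IsPath p × IsRainbow c p

  StrongRainbowConnecting : ∀ {m} → (Fin n → Fin n → Fin m) → Set
  StrongRainbowConnecting c = ∀ x y → x ≢ y →
    Σ (Walk x y) λ p → IsPath p × IsRainbow c p ×
      (∀ (q : Walk x y) → IsPath q → len p ≤ len q)

  rc*≡ : ℕ → Set
  rc*≡ k = (Σ (Fin n → Fin n → Fin k) RainbowConnecting)
         × (∀ m → m < k → ¬ Σ (Fin n → Fin n → Fin m) RainbowConnecting)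

  src*≡ : ℕ → Set
  src*≡ k = (Σ (Fin n → Fin n → Fin k) StrongRainbowConnecting)
          × (∀ m → m < k → ¬ Σ (Fin n → Fin n → Fin m) StrongRainbowConnecting)

-- Colour each arc by the residue modulo k of its head. Between v_a and v_{a+t} (0 ≤ t < 2k) a shortest
-- path is either t unit arcs (t < s) or one s-arc followed by t − s unit arcs; its vertices are distinct
-- modulo 2k and the heads of its arcs are at most k consecutive integers, so it is a rainbow geodesic.
-- Conversely the distance δ from a vertex drops by at most one along any arc (this is where
-- 2k ≤ 2s ≤ 2k + 2 is used), so no walk is shorter than δ; since some vertex is at distance k,
-- every rainbow-connecting colouring uses at least k colours.

module Submission where

open import Defs
open import Data.Nat
  using (ℕ; zero; suc; pred; _+_; _*_; _∸_; _≤_; _<_; z≤n; s≤s; _<?_;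
         NonZero; >-nonZero; >-nonZero⁻¹; ≢-nonZero⁻¹)
open import Data.Nat.Properties
open import Data.Nat.DivMod
open import Data.Nat.Divisibility using (_∣_; divides; ∣m+n∣m⇒∣n; ∣⇒≤; n∣m⇒m%n≡0)
open import Algebra.Properties.CommutativeSemigroup +-commutativeSemigroup
  using (xy∙z≈xz∙y; x∙yz≈y∙xz; interchange)
open import Data.Fin using (Fin; toℕ)
import Data.Fin as Fin
open import Data.Fin.Properties using (toℕ-injective; toℕ<n; toℕ-fromℕ<; injective⇒≤)
open import Data.List using (List; []; _∷_; length; lookup; applyUpTo)
open import Data.List.Membership.Propositional using (_∈_)
open import Data.List.Membership.Propositional.Properties using (∈-lookup)
open import Data.List.Relation.Unary.Any using (here; there)
import Data.List.Relation.Unary.All as All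
open import Data.List.Relation.Unary.Unique.Propositional using (Unique; []; _∷_)
open import Data.List.Relation.Unary.Unique.Propositional.Properties using (applyUpTo⁺₁)
open import Data.Product using (Σ; ∃-syntax; _×_; _,_)
open import Data.Sum using (inj₁; inj₂)
open import Function using (_∘_)
open import Relation.Nullary using (¬_; yes; no; contradiction)
open import Relation.Binary.PropositionalEquality

+1≡suc : ∀ m i → m + i + 1 ≡ m + suc i
+1≡suc m i = trans (+-comm (m + i) 1) (sym (+-suc m i))

shift-window : ∀ b {i j n} → i < j → j < i + n → b + i < b + j × b + j < b + i + n
shift-window b {i} {j} {n} i<j j<i+n =
  +-monoʳ-< b i<j , subst (b + j <_) (sym (+-assoc b i n)) (+-monoʳ-< b j<i+n)

module _ {n : ℕ} .{{_ : NonZero n}} where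

  [m%n+k]%n≡[m+k]%n : ∀ m k → (m % n + k) % n ≡ (m + k) % n
  [m%n+k]%n≡[m+k]%n m k = begin
    (m % n + k) % n               ≡⟨ [m+kn]%n≡m%n (m % n + k) (m / n) n ⟨
    (m % n + k + m / n * n) % n   ≡⟨ cong (_% n) (xy∙z≈xz∙y (m % n) k (m / n * n)) ⟩
    (m % n + m / n * n + k) % n   ≡⟨ cong (λ u → (u + k) % n) (m≡m%n+[m/n]*n m n) ⟨
    (m + k) % n                   ∎
    where open ≡-Reasoning

  toℕ-mod : ∀ m → toℕ (m mod n) ≡ m % n
  toℕ-mod m = toℕ-fromℕ< (m%n<n m n)

  mod-reflects-% : ∀ m m′ → m mod n ≡ m′ mod n → m % n ≡ m′ % n
  mod-reflects-% m m′ eq = trans (sym (toℕ-mod m)) (trans (cong toℕ eq) (toℕ-mod m′))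

  %≡toℕ⇒mod≡ : ∀ m (x : Fin n) → m % n ≡ toℕ x → m mod n ≡ x
  %≡toℕ⇒mod≡ m x eq = toℕ-injective (trans (toℕ-mod m) eq)

  [m+d]%n≡m%n⇒n∣d : ∀ m d → (m + d) % n ≡ m % n → n ∣ d
  [m+d]%n≡m%n⇒n∣d m d eq = ∣m+n∣m⇒∣n (divides ((m + d) / n) (+-cancelˡ-≡ (m % n) _ _ (begin
    m % n + (m / n * n + d)        ≡⟨ +-assoc (m % n) _ d ⟨
    m % n + m / n * n + d          ≡⟨ cong (_+ d) (m≡m%n+[m/n]*n m n) ⟨
    m + d                          ≡⟨ m≡m%n+[m/n]*n (m + d) n ⟩
    (m + d) % n + (m + d) / n * n  ≡⟨ cong (_+ (m + d) / n * n) eq ⟩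
    m % n + (m + d) / n * n        ∎))) (divides (m / n) refl)
    where open ≡-Reasoning

  %-distinct : ∀ {x y} → x < y → y < x + n → x % n ≢ y % n
  %-distinct {x} {y} x<y y<x+n eq = <⇒≱ d<n (∣⇒≤ {{>-nonZero (m<n⇒0<n∸m x<y)}} n∣d)
    where
    d<n : y ∸ x < n
    d<n = m<n+o⇒m∸n<o y x y<x+n
    n∣d : n ∣ y ∸ x
    n∣d = [m+d]%n≡m%n⇒n∣d x (y ∸ x) (trans (cong (_% n) (m+[n∸m]≡n (<⇒≤ x<y))) (sym eq))

  offset : ∀ (x y : Fin n) → ∃[ t ] t < n × (toℕ x + t) % n ≡ toℕ y
  offset x y = u % n , m%n<n u n , (begin
    (toℕ x + u % n) % n                ≡⟨ cong (_% n) (+-comm (toℕ x) (u % n)) ⟩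
    (u % n + toℕ x) % n                ≡⟨ [m%n+k]%n≡[m+k]%n u (toℕ x) ⟩
    (toℕ y + (n ∸ toℕ x) + toℕ x) % n  ≡⟨ cong (_% n) (+-assoc (toℕ y) _ (toℕ x)) ⟩
    (toℕ y + (n ∸ toℕ x + toℕ x)) % n  ≡⟨ cong (λ v → (toℕ y + v) % n) (m∸n+n≡m (<⇒≤ (toℕ<n x))) ⟩
    (toℕ y + n) % n                    ≡⟨ [m+n]%n≡m%n (toℕ y) n ⟩
    toℕ y % n                          ≡⟨ m<n⇒m%n≡m (toℕ<n y) ⟩
    toℕ y                              ∎)
    where
    open ≡-Reasoning
    u = toℕ y + (n ∸ toℕ x)

  -- t + (n ∸ σ) stands for t − σ modulo n.
  offset-step : ∀ {x z y : Fin n} {σ t} → σ ≤ n →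
    (toℕ x + σ) % n ≡ toℕ z → (toℕ x + t) % n ≡ toℕ y → (toℕ z + (t + (n ∸ σ))) % n ≡ toℕ y
  offset-step {x} {z} {y} {σ} {t} σ≤n x+σ≡z x+t≡y = begin
    (toℕ z + (t + (n ∸ σ))) % n             ≡⟨ cong (λ v → (v + (t + (n ∸ σ))) % n) x+σ≡z ⟨
    ((toℕ x + σ) % n + (t + (n ∸ σ))) % n   ≡⟨ [m%n+k]%n≡[m+k]%n (toℕ x + σ) (t + (n ∸ σ)) ⟩
    (toℕ x + σ + (t + (n ∸ σ))) % n         ≡⟨ cong (_% n) (interchange (toℕ x) σ t (n ∸ σ)) ⟩
    (toℕ x + t + (σ + (n ∸ σ))) % n         ≡⟨ cong (λ v → (toℕ x + t + v) % n) (m+[n∸m]≡n σ≤n) ⟩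
    (toℕ x + t + n) % n                     ≡⟨ [m+n]%n≡m%n (toℕ x + t) n ⟩
    (toℕ x + t) % n                         ≡⟨ x+t≡y ⟩
    toℕ y                                   ∎
    where open ≡-Reasoning

  Unique-applyUpTo-window : ∀ {A : Set} (h : ℕ → A) →
    (∀ m m′ → h m ≡ h m′ → m % n ≡ m′ % n) →
    ∀ (f : ℕ → ℕ) r → (∀ {i j} → i < j → j < r → f i < f j × f j < f i + n) →
    Unique (applyUpTo (h ∘ f) r)
  Unique-applyUpTo-window h h-reflects f r window = applyUpTo⁺₁ (h ∘ f) r λ i<j j<r eq →
    let f[i]<f[j] , f[j]<f[i]+n = window i<j j<r
    in %-distinct f[i]<f[j] f[j]<f[i]+n (h-reflects _ _ eq)

Unique-lookup-injective : ∀ {A : Set} {xs : List A} → Unique xs →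
  ∀ i j → lookup xs i ≡ lookup xs j → i ≡ j
Unique-lookup-injective (_ ∷ _) Fin.zero Fin.zero _ = refl
Unique-lookup-injective (x∉xs ∷ _) Fin.zero (Fin.suc j) eq =
  contradiction eq (All.lookup x∉xs (∈-lookup j))
Unique-lookup-injective (x∉xs ∷ _) (Fin.suc i) Fin.zero eq =
  contradiction (sym eq) (All.lookup x∉xs (∈-lookup i))
Unique-lookup-injective (_ ∷ u) (Fin.suc i) (Fin.suc j) eq =
  cong Fin.suc (Unique-lookup-injective u i j eq)

Unique⇒length≤ : ∀ {m} {xs : List (Fin m)} → Unique xs → length xs ≤ m
Unique⇒length≤ u = injective⇒≤ (Unique-lookup-injective u _ _)

module _ {n : ℕ} (D : Digraph n) where

  trail : (g : ℕ → Fin n) → (∀ i → D (g i) (g (suc i))) → ∀ r → Walk D (g 0) (g r)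
  trail g step zero    = []
  trail g step (suc r) = step 0 ∷ trail (g ∘ suc) (step ∘ suc) r

  vertices-trail : ∀ g step r → vertices D (trail g step r) ≡ applyUpTo g (suc r)
  vertices-trail g step zero    = refl
  vertices-trail g step (suc r) = cong (g 0 ∷_) (vertices-trail (g ∘ suc) (step ∘ suc) r)

  colours-trail : ∀ {m} (f : Fin n → Fin m) g step r →
    colours D (λ _ y → f y) (trail g step r) ≡ applyUpTo (f ∘ g ∘ suc) r
  colours-trail f g step zero    = refl
  colours-trail f g step (suc r) = cong (f (g 1) ∷_) (colours-trail f (g ∘ suc) (step ∘ suc) r)

  len-trail : ∀ g step r → len D (trail g step r) ≡ r
  len-trail g step zero    = refl
  len-trail g step (suc r) = cong suc (len-trail (g ∘ suc) (step ∘ suc) r)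

  length-colours : ∀ {m} (c : Fin n → Fin n → Fin m) {x y} (w : Walk D x y) →
    length (colours D c w) ≡ len D w
  length-colours c []      = refl
  length-colours c (_ ∷ w) = cong suc (length-colours c w)

  rainbow⇒len≤ : ∀ {m} (c : Fin n → Fin n → Fin m) {x y} (w : Walk D x y) →
    IsRainbow D c w → len D w ≤ m
  rainbow⇒len≤ c w rainbow = subst (_≤ _) (length-colours c w) (Unique⇒length≤ rainbow)

  strong⇒rainbowConnecting : ∀ {m} {c : Fin n → Fin n → Fin m} →
    StrongRainbowConnecting D c → RainbowConnecting D c
  strong⇒rainbowConnecting strong x y x≢y =
    let p , path , rainbow , _ = strong x y x≢y in p , path , rainbow

  rc*≡×src*≡ : ∀ {k} → Σ (Fin n → Fin n → Fin k) (StrongRainbowConnecting D) →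
    (∀ m → m < k → ¬ Σ (Fin n → Fin n → Fin m) (RainbowConnecting D)) →
    rc*≡ D k × src*≡ D k
  rc*≡×src*≡ (c , strong) fewer-fail =
    ((c , strong⇒rainbowConnecting strong) , fewer-fail) ,
    ((c , strong) , λ m m<k (c′ , strong′) → fewer-fail m m<k (c′ , strong⇒rainbowConnecting strong′))

module _ {n : ℕ} .{{_ : NonZero n}} {S : List ℕ} where

  circulant-arc : ∀ {σ} → σ ∈ S → ∀ m {m′} → m + σ ≡ m′ → Circulant n S (m mod n) (m′ mod n)
  circulant-arc {σ} σ∈S m refl = σ , σ∈S , w / n , (begin
    toℕ (m mod n) + σ               ≡⟨ cong (_+ σ) (toℕ-mod m) ⟩
    w                               ≡⟨ m≡m%n+[m/n]*n w n ⟩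
    w % n + w / n * n               ≡⟨ cong (_+ w / n * n) ([m%n+k]%n≡[m+k]%n m σ) ⟩
    (m + σ) % n + w / n * n         ≡⟨ cong (_+ w / n * n) (toℕ-mod (m + σ)) ⟨
    toℕ ((m + σ) mod n) + w / n * n ∎)
    where
    open ≡-Reasoning
    w = m % n + σ

  circulant-arc⁻¹ : ∀ {x z} → Circulant n S x z → ∃[ σ ] σ ∈ S × (toℕ x + σ) % n ≡ toℕ z
  circulant-arc⁻¹ {x} {z} (σ , σ∈S , q , eq) =
    σ , σ∈S , trans (cong (_% n) eq) (trans ([m+kn]%n≡m%n (toℕ z) q n) (m<n⇒m%n≡m (toℕ<n z)))

module Circulant2k (k s : ℕ) .{{_ : NonZero k}} (k≤s : k ≤ s) (s≤1+k : s ≤ suc k) where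

  open ≤-Reasoning

  n : ℕ
  n = k + k

  0<k : 0 < k
  0<k = >-nonZero⁻¹ k

  0<n : 0 < n
  0<n = <-≤-trans 0<k (m≤m+n k k)

  instance
    n-nonZero : NonZero n
    n-nonZero = >-nonZero 0<n

  D : Digraph n
  D = Circulant n (1 ∷ s ∷ [])

  V : ℕ → Fin n
  V m = m mod n

  0<s : 0 < s
  0<s = <-≤-trans 0<k k≤s

  instance
    s-nonZero : NonZero s
    s-nonZero = >-nonZero 0<s

  s≤n : s ≤ n
  s≤n = ≤-trans s≤1+k (m<m+n k 0<k)

  n≤s+s : n ≤ s + s
  n≤s+s = +-mono-≤ k≤s k≤s

  s+s≤2+n : s + s ≤ 2 + n
  s+s≤2+n = ≤-trans (+-mono-≤ s≤1+k s≤1+k) (≤-reflexive (cong suc (+-suc k k)))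

  -- δ t is the distance from v₀ to v_t for t < n: t unit arcs, or one s-arc followed by t ∸ s unit arcs.
  δ : ℕ → ℕ
  δ t with t <? s
  ... | yes _ = t
  ... | no  _ = suc (t ∸ s)

  δ-< : ∀ {t} → t < s → δ t ≡ t
  δ-< {t} t<s with t <? s
  ... | yes _   = refl
  ... | no  t≮s = contradiction t<s t≮s

  δ-≥ : ∀ {t} → s ≤ t → δ t ≡ suc (t ∸ s)
  δ-≥ {t} s≤t with t <? s
  ... | yes t<s = contradiction s≤t (<⇒≱ t<s)
  ... | no  _   = refl

  δ-0 : δ 0 ≡ 0
  δ-0 = δ-< 0<s

  δ-suc : ∀ t → δ (suc t) ≤ suc (δ t)
  δ-suc t with <-≤-connex (suc t) s | <-≤-connex t s
  ... | inj₁ 1+t<s | _ = begin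
    δ (suc t)           ≡⟨ δ-< 1+t<s ⟩
    suc t               ≡⟨ cong suc (δ-< (<-trans (n<1+n t) 1+t<s)) ⟨
    suc (δ t)           ∎
  ... | inj₂ s≤1+t | inj₁ t<s = begin
    δ (suc t)           ≡⟨ δ-≥ s≤1+t ⟩
    suc (suc t ∸ s)     ≡⟨ cong suc (m≤n⇒m∸n≡0 t<s) ⟩
    1                   ≤⟨ s≤s z≤n ⟩
    suc (δ t)           ∎
  ... | inj₂ s≤1+t | inj₂ s≤t = begin
    δ (suc t)           ≡⟨ δ-≥ s≤1+t ⟩
    suc (suc t ∸ s)     ≡⟨ cong suc (+-∸-assoc 1 s≤t) ⟩
    suc (suc (t ∸ s))   ≡⟨ cong suc (δ-≥ s≤t) ⟨
    suc (δ t)           ∎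

  δ-+s : ∀ {r} → r + s < n → δ (r + s) ≤ suc (δ r)
  δ-+s {r} r+s<n = begin
    δ (r + s)           ≡⟨ δ-≥ (m≤n+m s r) ⟩
    suc (r + s ∸ s)     ≡⟨ cong suc (m+n∸n≡m r s) ⟩
    suc r               ≡⟨ cong suc (δ-< (+-cancelʳ-< s r s (<-≤-trans r+s<n n≤s+s))) ⟨
    suc (δ r)           ∎

  r+s∸n<s : ∀ {r} → r < n → r + s ∸ n < s
  r+s∸n<s {r} r<n = m<n+o⇒m∸n<o (r + s) n (+-monoˡ-< s r<n)

  δ-wrap : ∀ {r} → r < n → δ (r + s ∸ n) ≤ suc (δ r)
  δ-wrap {r} r<n with <-≤-connex r s
  ... | inj₁ r<s = begin
    δ (r + s ∸ n)   ≡⟨ δ-< (r+s∸n<s r<n) ⟩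
    r + s ∸ n       ≤⟨ m≤n+o⇒m∸n≤o (r + s) n (subst (r + s ≤_) (+-comm r n) (+-monoʳ-≤ r s≤n)) ⟩
    r               ≤⟨ n≤1+n r ⟩
    suc r           ≡⟨ cong suc (δ-< r<s) ⟨
    suc (δ r)       ∎
  ... | inj₂ s≤r = begin
    δ (r + s ∸ n)   ≡⟨ δ-< (r+s∸n<s r<n) ⟩
    r + s ∸ n       ≤⟨ m≤n+o⇒m∸n≤o (r + s) n r+s≤n+[2+u] ⟩
    2 + u           ≡⟨ cong suc (δ-≥ s≤r) ⟨
    suc (δ r)       ∎
    where
    u = r ∸ s
    r+s≤n+[2+u] : r + s ≤ n + (2 + u)
    r+s≤n+[2+u] = begin
      r + s         ≡⟨ cong (_+ s) (m∸n+n≡m s≤r) ⟨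
      u + s + s     ≡⟨ +-assoc u s s ⟩
      u + (s + s)   ≤⟨ +-monoʳ-≤ u s+s≤2+n ⟩
      u + (2 + n)   ≡⟨ x∙yz≈y∙xz u 2 n ⟩
      2 + (u + n)   ≡⟨ cong (2 +_) (+-comm u n) ⟩
      2 + (n + u)   ≡⟨ x∙yz≈y∙xz n 2 u ⟨
      n + (2 + u)   ∎

  δ-step : ∀ {r σ} → r < n → σ ∈ (1 ∷ s ∷ []) → δ ((r + σ) % n) ≤ suc (δ r)
  δ-step {r} r<n (here refl) with <-≤-connex (r + 1) n
  ... | inj₁ r+1<n = begin
    δ ((r + 1) % n)   ≡⟨ cong δ (trans (m<n⇒m%n≡m r+1<n) (+-comm r 1)) ⟩
    δ (suc r)         ≤⟨ δ-suc r ⟩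
    suc (δ r)         ∎
  ... | inj₂ n≤r+1 = begin
    δ ((r + 1) % n)   ≡⟨ cong (δ ∘ (_% n)) (≤-antisym (subst (_≤ n) (+-comm 1 r) r<n) n≤r+1) ⟩
    δ (n % n)         ≡⟨ cong δ (n%n≡0 n) ⟩
    δ 0               ≡⟨ δ-0 ⟩
    0                 ≤⟨ z≤n ⟩
    suc (δ r)         ∎
  δ-step {r} r<n (there (here refl)) with <-≤-connex (r + s) n
  ... | inj₁ r+s<n = begin
    δ ((r + s) % n)   ≡⟨ cong δ (m<n⇒m%n≡m r+s<n) ⟩
    δ (r + s)         ≤⟨ δ-+s r+s<n ⟩
    suc (δ r)         ∎
  ... | inj₂ n≤r+s = begin
    δ ((r + s) % n)   ≡⟨ cong δ (m≤n⇒[n∸m]%m≡n%m n≤r+s) ⟨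
    δ ((r + s ∸ n) % n) ≡⟨ cong δ (m<n⇒m%n≡m (<-≤-trans (r+s∸n<s r<n) s≤n)) ⟩
    δ (r + s ∸ n)     ≤⟨ δ-wrap r<n ⟩
    suc (δ r)         ∎

  Δ : ℕ → ℕ
  Δ t = δ (t % n)

  Δ-step : ∀ t {σ} → σ ∈ (1 ∷ s ∷ []) → Δ (t + σ) ≤ suc (Δ t)
  Δ-step t {σ} σ∈S = begin
    δ ((t + σ) % n)       ≡⟨ cong δ ([m%n+k]%n≡[m+k]%n {n = n} t σ) ⟨
    δ ((t % n + σ) % n)   ≤⟨ δ-step (m%n<n t n) σ∈S ⟩
    suc (Δ t)             ∎

  σ≤n : ∀ {σ} → σ ∈ (1 ∷ s ∷ []) → σ ≤ n
  σ≤n (here refl)         = 0<n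
  σ≤n (there (here refl)) = s≤n

  walk-length≥ : ∀ {x y} (w : Walk D x y) t → (toℕ x + t) % n ≡ toℕ y → Δ t ≤ len D w
  walk-length≥ {x} [] t x+t≡x = ≤-reflexive (trans (cong δ t%n≡0) δ-0)
    where
    t%n≡0 : t % n ≡ 0
    t%n≡0 = n∣m⇒m%n≡0 t n
      ([m+d]%n≡m%n⇒n∣d (toℕ x) t (trans x+t≡x (sym (m<n⇒m%n≡m (toℕ<n x)))))
  walk-length≥ {x} (arc ∷ w) t x+t≡y with circulant-arc⁻¹ arc
  ... | σ , σ∈S , x+σ≡z = begin
    Δ t                 ≡⟨ cong δ ([m+n]%n≡m%n t n) ⟨
    Δ (t + n)           ≡⟨ cong Δ t+n≡t′+σ ⟩
    Δ (t′ + σ)          ≤⟨ Δ-step t′ σ∈S ⟩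
    suc (Δ t′)          ≤⟨ s≤s (walk-length≥ w t′ (offset-step (σ≤n σ∈S) x+σ≡z x+t≡y)) ⟩
    suc (len D w)       ∎
    where
    t′ = t + (n ∸ σ)
    t+n≡t′+σ : t + n ≡ t′ + σ
    t+n≡t′+σ = trans (cong (t +_) (sym (m∸n+n≡m (σ≤n σ∈S)))) (sym (+-assoc t (n ∸ σ) σ))

  colour : Fin n → Fin k
  colour y = toℕ y mod k

  colouring : Fin n → Fin n → Fin k
  colouring _ y = colour y

  colour-reflects-% : ∀ m m′ → colour (V m) ≡ colour (V m′) → m % k ≡ m′ % k
  colour-reflects-% m m′ eq = begin-equality
    m % k               ≡⟨ m∣n⇒o%n%m≡o%m k n m k∣n ⟨
    m % n % k           ≡⟨ cong (_% k) (toℕ-mod m) ⟨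
    toℕ (V m) % k       ≡⟨ mod-reflects-% (toℕ (V m)) (toℕ (V m′)) eq ⟩
    toℕ (V m′) % k      ≡⟨ cong (_% k) (toℕ-mod m′) ⟩
    m′ % n % k          ≡⟨ m∣n⇒o%n%m≡o%m k n m′ k∣n ⟩
    m′ % k              ∎
    where
    k∣n : k ∣ n
    k∣n = divides 2 (cong (k +_) (sym (+-identityʳ k)))

  RainbowGeodesic : Fin n → Fin n → ℕ → Set
  RainbowGeodesic x y ℓ = Σ (Walk D x y) λ p → IsPath D p × IsRainbow D colouring p × len D p ≡ ℓ

  unit-geodesic : ∀ a t → t < s → RainbowGeodesic (V (a + 0)) (V (a + t)) (δ t)
  unit-geodesic a t t<s =
    trail D g step t ,
    subst Unique (sym (vertices-trail D g step t))
      (Unique-applyUpTo-window {n = n} (_mod n) mod-reflects-% (a +_) (suc t) λ {i} i<j j<1+t →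
        shift-window a i<j (<-≤-trans j<1+t (≤-trans t<n (m≤n+m n i)))) ,
    subst Unique (sym (colours-trail D colour g step t))
      (Unique-applyUpTo-window {n = k} (colour ∘ V) colour-reflects-% (λ i → a + suc i) t
        λ {i} i<j j<t →
        shift-window a (s≤s i<j) (s≤s (<-≤-trans j<t (≤-trans t≤k (m≤n+m k i))))) ,
    trans (len-trail D g step t) (sym (δ-< t<s))
    where
    g : ℕ → Fin n
    g i = V (a + i)
    step : ∀ i → D (g i) (g (suc i))
    step i = circulant-arc (here refl) (a + i) (+1≡suc a i)
    t<n : t < n
    t<n = <-≤-trans t<s s≤n
    t≤k : t ≤ k
    t≤k = ≤-pred (<-≤-trans t<s s≤1+k)

  jump-geodesic : ∀ a t → s ≤ t → t < n → RainbowGeodesic (V a) (V (a + s + (t ∸ s))) (δ t)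
  jump-geodesic a t s≤t t<n =
    trail D g step (suc r) ,
    subst Unique (sym (vertices-trail D g step (suc r)))
      (Unique-applyUpTo-window {n = n} (_mod n) mod-reflects-% f (suc (suc r)) vertex-window) ,
    subst Unique (sym (colours-trail D colour g step (suc r)))
      (Unique-applyUpTo-window {n = k} (colour ∘ V) colour-reflects-% (λ i → a + s + i) (suc r)
        λ {i} i<j j<1+r →
        shift-window (a + s) i<j (<-≤-trans j<1+r (≤-trans r<k (m≤n+m k i)))) ,
    trans (len-trail D g step (suc r)) (sym (δ-≥ s≤t))
    where
    r = t ∸ s
    f : ℕ → ℕ
    f zero    = a
    f (suc i) = a + s + i
    g : ℕ → Fin n
    g = V ∘ f
    step : ∀ i → D (g i) (g (suc i))
    step zero    = circulant-arc (there (here refl)) a (sym (+-identityʳ (a + s)))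
    step (suc i) = circulant-arc (here refl) (a + s + i) (+1≡suc (a + s) i)
    r<k : r < k
    r<k = ≤-<-trans (∸-monoʳ-≤ t k≤s) (m<n+o⇒m∸n<o t k t<n)
    vertex-window : ∀ {i j} → i < j → j < suc (suc r) → f i < f j × f j < f i + n
    vertex-window {zero}  {suc j} _ (s≤s (s≤s j≤r)) =
      <-≤-trans (m<m+n a 0<s) (m≤m+n (a + s) j) ,
      subst (_< a + n) (sym (+-assoc a s j))
        (+-monoʳ-< a (≤-<-trans (subst (s + j ≤_) (m+[n∸m]≡n s≤t) (+-monoʳ-≤ s j≤r)) t<n))
    vertex-window {suc i} {suc j} (s≤s i<j) (s≤s (s≤s j≤r)) =
      shift-window (a + s) i<j (≤-<-trans (≤-trans j≤r (m∸n≤m t s)) (<-≤-trans t<n (m≤n+m n i)))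

  rainbow-geodesic : ∀ (x y : Fin n) t → t < n → (toℕ x + t) % n ≡ toℕ y → RainbowGeodesic x y (δ t)
  rainbow-geodesic x y t t<n x+t≡y with <-≤-connex t s
  ... | inj₁ t<s = subst₂ (λ u v → RainbowGeodesic u v (δ t))
    (%≡toℕ⇒mod≡ (a + 0) x (trans (cong (_% n) (+-identityʳ a)) a%n≡a))
    (%≡toℕ⇒mod≡ (a + t) y x+t≡y)
    (unit-geodesic a t t<s)
    where a = toℕ x; a%n≡a = m<n⇒m%n≡m (toℕ<n x)
  ... | inj₂ s≤t = subst₂ (λ u v → RainbowGeodesic u v (δ t))
    (%≡toℕ⇒mod≡ a x (m<n⇒m%n≡m (toℕ<n x)))
    (%≡toℕ⇒mod≡ (a + s + (t ∸ s)) y (trans (cong (_% n) a+s+[t∸s]≡a+t) x+t≡y))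
    (jump-geodesic a t s≤t t<n)
    where
    a = toℕ x
    a+s+[t∸s]≡a+t : a + s + (t ∸ s) ≡ a + t
    a+s+[t∸s]≡a+t = trans (+-assoc a s (t ∸ s)) (cong (a +_) (m+[n∸m]≡n s≤t))

  strongly-rainbow-connected : StrongRainbowConnecting D colouring
  strongly-rainbow-connected x y _ =
    let t , t<n , x+t≡y = offset x y
        p , path , rainbow , len≡δt = rainbow-geodesic x y t t<n x+t≡y
    in p , path , rainbow , λ q _ → begin
      len D p   ≡⟨ len≡δt ⟩
      δ t       ≡⟨ cong δ (m<n⇒m%n≡m t<n) ⟨
      Δ t       ≤⟨ walk-length≥ q t x+t≡y ⟩
      len D q   ∎

  diameter : ∃[ b ] b < n × δ b ≡ k
  diameter with m≤n⇒m<n∨m≡n k≤s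
  ... | inj₁ k<s = k , m<m+n k 0<k , δ-< k<s
  ... | inj₂ k≡s = s + pred k , b<n ,
    trans (δ-≥ (m≤m+n s (pred k))) (trans (cong suc (m+n∸m≡n s (pred k))) (suc-pred k))
    where
    b<n : s + pred k < n
    b<n = subst (λ v → v + pred k < n) k≡s
      (+-monoʳ-< k (subst (pred k <_) (suc-pred k) (n<1+n (pred k))))

  rainbowConnecting⇒k≤m : ∀ {m} → Σ (Fin n → Fin n → Fin m) (RainbowConnecting D) → k ≤ m
  rainbowConnecting⇒k≤m {m} (c , connecting) =
    let b , b<n , δb≡k = diameter
        p , _ , rainbow = connecting (V 0) (V b) (V0≢Vb b b<n δb≡k)
    in begin
      k         ≡⟨ δb≡k ⟨
      δ b       ≡⟨ cong δ (m<n⇒m%n≡m b<n) ⟨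
      Δ b       ≤⟨ walk-length≥ p b (0+b≡b b) ⟩
      len D p   ≤⟨ rainbow⇒len≤ D c p rainbow ⟩
      m         ∎
    where
    0%n≡0 : 0 % n ≡ 0
    0%n≡0 = m<n⇒m%n≡m 0<n
    0+b≡b : ∀ b → (toℕ (V 0) + b) % n ≡ toℕ (V b)
    0+b≡b b = trans (cong (λ v → (v + b) % n) (trans (toℕ-mod 0) 0%n≡0)) (sym (toℕ-mod b))
    V0≢Vb : ∀ b → b < n → δ b ≡ k → V 0 ≢ V b
    V0≢Vb b b<n δb≡k V0≡Vb = ≢-nonZero⁻¹ k (trans (sym δb≡k) (trans (cong δ b≡0) δ-0))
      where
      b≡0 : b ≡ 0
      b≡0 = trans (sym (m<n⇒m%n≡m b<n)) (trans (sym (mod-reflects-% 0 b V0≡Vb)) 0%n≡0)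

  rc*≡k×src*≡k : rc*≡ D k × src*≡ D k
  rc*≡k×src*≡k = rc*≡×src*≡ D (colouring , strongly-rainbow-connected)
    λ m m<k connecting → <⇒≱ m<k (rainbowConnecting⇒k≤m connecting)

theorem9 : (k : ℕ) → 2 ≤ k →
    (rc*≡ (Circulant (k + k) (1 ∷ k ∷ [])) k × src*≡ (Circulant (k + k) (1 ∷ k ∷ [])) k)
    × (rc*≡ (Circulant (k + k) (1 ∷ (k + 1) ∷ [])) k × src*≡ (Circulant (k + k) (1 ∷ (k + 1) ∷ [])) k)
theorem9 k@(suc _) _ =
  Circulant2k.rc*≡k×src*≡k k k ≤-refl (n≤1+n k) ,
  Circulant2k.rc*≡k×src*≡k k (k + 1) (m≤m+n k 1) (≤-reflexive (+-comm k 1))
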